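{- For $M\in\Lambda$, the following are equivalent: (1) $M$ is in $\mathsf v$-normal form; (2) every $t\in\mathcal T(M)$ is in $\beta_r\sigma$-normal form, i.e. contains no subterm that is a $\beta_r$-, $\sigma_1$- or $\sigma_3$-redex.
   Context: Call-by-value $\lambda$-calculus: $\Lambda$ is the set of $\lambda$-terms $M::=x\mid\lambda x.M\mid MN$ up to $\alpha$-conversion; values are variables and abstractions. $\mathsf v$-redexes: $(\beta_v)$ $(\lambda x.M)V$ with $V$ a value; $(\sigma_1)$ $(\lambda x.M)NP$ (with $x\notin FV(P)$, up to $\alpha$); $(\sigma_3)$ $V((\lambda x.M)N)$ with $V$ a value (with $x\notin FV(V)$, up to $\alpha$). $M$ is in $\mathsf v$-normal form if it contains no $\mathsf v$-redex. Resource calculus: resource values $v::=x\mid\lambda x.t$; simple terms $s,t::=st\mid[v_1,\dots,v_k]$ ($k\ge0$, finite multisets). Redexes: $\beta_r$-redex $[\lambda x.t][v_1,\dots,v_n]$; $\sigma_1$-redex $[\lambda x.t]s_1s_2$; $\sigma_3$-redex $[v]([\lambda x.t]s)$. Taylor expansion: $\mathcal T(x)=\{[x,\dots,x]\ (n\text{ copies})\mid n\ge0\}$, $\mathcal T(\lambda x.N)=\{[\lambda x.t_1,\dots,\lambda x.t_n]\mid n\ge0,\ t_i\in\mathcal T(N)\}$, $\mathcal T(PQ)=\{st\mid s\in\mathcal T(P),t\in\mathcal T(Q)\}$. -}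

module Defs where

open import Data.Nat using (ℕ)
open import Data.List using (List; []; _∷_; map; replicate)
open import Data.List.Relation.Unary.All using (All)
open import Data.List.Relation.Unary.Any using (Any)
open import Relation.Nullary using (¬_)

data Λ : Set where
  var : ℕ → Λ
  lam : Λ → Λ
  app : Λ → Λ → Λ

data IsValue : Λ → Set where
  var : ∀ x → IsValue (var x)
  lam : ∀ M → IsValue (lam M)

-- v-redexes.  The side conditions x ∉ FV(P), x ∉ FV(V) "up to α" are
-- vacuous with de Bruijn indices (one can always rename the bound x).
data VRedex : Λ → Set where
  βv : ∀ M V → IsValue V → VRedex (app (lam M) V)
  σ₁ : ∀ M N P → VRedex (app (app (lam M) N) P)
  σ₃ : ∀ V M N → IsValue V → VRedex (app V (app (lam M) N))

data HasVRedex : Λ → Set where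
  here  : ∀ {M} → VRedex M → HasVRedex M
  inLam : ∀ {M} → HasVRedex M → HasVRedex (lam M)
  inAppˡ : ∀ {M N} → HasVRedex M → HasVRedex (app M N)
  inAppʳ : ∀ {M N} → HasVRedex N → HasVRedex (app M N)

VNormal : Λ → Set
VNormal M = ¬ HasVRedex M

-- Resource calculus (finite multisets represented by lists; being a
-- redex / normal form / Taylor-expansion membership is invariant
-- under permutation of these lists)

mutual
  data RVal : Set where
    rvar : ℕ → RVal
    rlam : RTerm → RVal

  data RTerm : Set where
    rapp : RTerm → RTerm → RTerm
    bag  : List RVal → RTerm

data RRedex : RTerm → Set where
  βr : ∀ t vs → RRedex (rapp (bag (rlam t ∷ [])) (bag vs))
  σ₁ : ∀ t s₁ s₂ → RRedex (rapp (rapp (bag (rlam t ∷ [])) s₁) s₂)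
  σ₃ : ∀ v t s → RRedex (rapp (bag (v ∷ [])) (rapp (bag (rlam t ∷ [])) s))

mutual
  data HasRRedex : RTerm → Set where
    here   : ∀ {t} → RRedex t → HasRRedex t
    inAppˡ : ∀ {s t} → HasRRedex s → HasRRedex (rapp s t)
    inAppʳ : ∀ {s t} → HasRRedex t → HasRRedex (rapp s t)
    inBag  : ∀ {vs} → Any HasRRedexV vs → HasRRedex (bag vs)

  data HasRRedexV : RVal → Set where
    inLam : ∀ {t} → HasRRedex t → HasRRedexV (rlam t)

RNormal : RTerm → Set
RNormal t = ¬ HasRRedex t

data _∈T_ : RTerm → Λ → Set where
  var : ∀ x n → bag (replicate n (rvar x)) ∈T var x
  lam : ∀ {N} (ts : List RTerm) → All (_∈T N) ts → bag (map rlam ts) ∈T lam N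
  app : ∀ {P Q s t} → s ∈T P → t ∈T Q → rapp s t ∈T app P Q

-- A resource term in 𝒯(M) has the shape of M; a bag holding some λx.t can
-- only expand an abstraction, and any bag expands a value.  So every βr-, σ₁-
-- or σ₃-redex inside some t ∈ 𝒯(M) lies over a v-redex of M at the same
-- position.  Conversely, a v-redex of M becomes a resource redex once its head
-- abstraction (and, for σ₃, its value) is expanded to a one-element bag, the
-- argument of a βv-redex to the empty bag, and every other subterm arbitrarily.
module Submission where

open import Defs
open import Data.Product using (_×_; ∃; _,_)
open import Data.Nat using (zero; suc)
open import Data.List using ([]; _∷_; map; replicate)
open import Data.List.Relation.Unary.All using (All; []; _∷_)
open import Data.List.Relation.Unary.Any using (Any; here; there)
open import Relation.Nullary using (¬_)
open import Relation.Binary.PropositionalEquality using (_≡_; refl)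

∈T-bag⇒IsValue : ∀ {vs P} → bag vs ∈T P → IsValue P
∈T-bag⇒IsValue (var x n)  = var x
∈T-bag⇒IsValue (lam ts _) = lam _

-- The bag is kept as a variable index: matching directly against
-- bag (rlam t ∷ vs) gets stuck on replicate n (rvar x).
∈T-rlam⇒lam : ∀ {b P t vs} → b ∈T P → b ≡ bag (rlam t ∷ vs) → ∃ λ N → P ≡ lam N
∈T-rlam⇒lam (var x zero)    ()
∈T-rlam⇒lam (var x (suc n)) ()
∈T-rlam⇒lam (lam ts _)      _    = _ , refl

RRedex-∈T⇒VRedex : ∀ {t M} → RRedex t → t ∈T M → VRedex M
RRedex-∈T⇒VRedex (βr _ _) (app d e) with ∈T-rlam⇒lam d refl
... | N , refl = βv N _ (∈T-bag⇒IsValue e)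
RRedex-∈T⇒VRedex (σ₁ _ _ _) (app (app d _) _) with ∈T-rlam⇒lam d refl
... | N , refl = σ₁ N _ _
RRedex-∈T⇒VRedex (σ₃ _ _ _) (app d (app e _)) with ∈T-rlam⇒lam e refl
... | N , refl = σ₃ _ N _ (∈T-bag⇒IsValue d)

replicate-rvar-normal : ∀ x n → ¬ Any HasRRedexV (replicate n (rvar x))
replicate-rvar-normal x (suc n) (here ())
replicate-rvar-normal x (suc n) (there r) = replicate-rvar-normal x n r

mutual
  HasRRedex-∈T⇒HasVRedex : ∀ {t M} → t ∈T M → HasRRedex t → HasVRedex M
  HasRRedex-∈T⇒HasVRedex d           (here r)   = here (RRedex-∈T⇒VRedex r d)
  HasRRedex-∈T⇒HasVRedex (app d _)   (inAppˡ r) = inAppˡ (HasRRedex-∈T⇒HasVRedex d r)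
  HasRRedex-∈T⇒HasVRedex (app _ e)   (inAppʳ r) = inAppʳ (HasRRedex-∈T⇒HasVRedex e r)
  HasRRedex-∈T⇒HasVRedex (lam ts ds) (inBag r)  = inLam (Any-HasRRedex-∈T⇒HasVRedex ts ds r)
  HasRRedex-∈T⇒HasVRedex (var x n)   (inBag r)  with () ← replicate-rvar-normal x n r

  Any-HasRRedex-∈T⇒HasVRedex : ∀ {N} ts → All (_∈T N) ts →
                               Any HasRRedexV (map rlam ts) → HasVRedex N
  Any-HasRRedex-∈T⇒HasVRedex (_ ∷ _)  (d ∷ _)  (here (inLam r)) = HasRRedex-∈T⇒HasVRedex d r
  Any-HasRRedex-∈T⇒HasVRedex (_ ∷ ts) (_ ∷ ds) (there r)        = Any-HasRRedex-∈T⇒HasVRedex ts ds r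

𝒯-nonempty : ∀ M → ∃ (_∈T M)
𝒯-nonempty (var x)   = _ , var x 0
𝒯-nonempty (lam M)   = _ , lam [] []
𝒯-nonempty (app M N) with 𝒯-nonempty M | 𝒯-nonempty N
... | _ , d | _ , e = _ , app d e

singleton-∈T-lam : ∀ M → ∃ λ t → bag (rlam t ∷ []) ∈T lam M
singleton-∈T-lam M with 𝒯-nonempty M
... | t , d = t , lam (t ∷ []) (d ∷ [])

IsValue⇒empty-bag-∈T : ∀ {V} → IsValue V → bag [] ∈T V
IsValue⇒empty-bag-∈T (var x) = var x 0
IsValue⇒empty-bag-∈T (lam M) = lam [] []

IsValue⇒singleton-∈T : ∀ {V} → IsValue V → ∃ λ v → bag (v ∷ []) ∈T V
IsValue⇒singleton-∈T (var x) = rvar x , var x 1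
IsValue⇒singleton-∈T (lam M) with singleton-∈T-lam M
... | t , d = rlam t , d

VRedex⇒∃RRedex-∈T : ∀ {M} → VRedex M → ∃ λ t → t ∈T M × RRedex t
VRedex⇒∃RRedex-∈T (βv M V v) with singleton-∈T-lam M
... | _ , d = _ , app d (IsValue⇒empty-bag-∈T v) , βr _ _
VRedex⇒∃RRedex-∈T (σ₁ M N P) with singleton-∈T-lam M | 𝒯-nonempty N | 𝒯-nonempty P
... | _ , d | _ , e | _ , f = _ , app (app d e) f , σ₁ _ _ _
VRedex⇒∃RRedex-∈T (σ₃ V M N v) with IsValue⇒singleton-∈T v | singleton-∈T-lam M | 𝒯-nonempty N
... | _ , d | _ , e | _ , f = _ , app d (app e f) , σ₃ _ _ _

HasVRedex⇒∃HasRRedex-∈T : ∀ {M} → HasVRedex M → ∃ λ t → t ∈T M × HasRRedex t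
HasVRedex⇒∃HasRRedex-∈T (here r) with VRedex⇒∃RRedex-∈T r
... | _ , d , ρ = _ , d , here ρ
HasVRedex⇒∃HasRRedex-∈T (inLam r) with HasVRedex⇒∃HasRRedex-∈T r
... | t , d , ρ = _ , lam (t ∷ []) (d ∷ []) , inBag (here (inLam ρ))
HasVRedex⇒∃HasRRedex-∈T {app _ N} (inAppˡ r) with HasVRedex⇒∃HasRRedex-∈T r | 𝒯-nonempty N
... | _ , d , ρ | _ , e = _ , app d e , inAppˡ ρ
HasVRedex⇒∃HasRRedex-∈T {app M _} (inAppʳ r) with 𝒯-nonempty M | HasVRedex⇒∃HasRRedex-∈T r
... | _ , d | _ , e , ρ = _ , app d e , inAppʳ ρ

lemma3p13 : (M : Λ) →
    ((VNormal M → (t : RTerm) → t ∈T M → RNormal t)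
    × (((t : RTerm) → t ∈T M → RNormal t) → VNormal M))
lemma3p13 M = vNormal⇒𝒯-normal , 𝒯-normal⇒vNormal
  where
  vNormal⇒𝒯-normal : VNormal M → (t : RTerm) → t ∈T M → RNormal t
  vNormal⇒𝒯-normal nf t d r = nf (HasRRedex-∈T⇒HasVRedex d r)

  𝒯-normal⇒vNormal : ((t : RTerm) → t ∈T M → RNormal t) → VNormal M
  𝒯-normal⇒vNormal nf r with HasVRedex⇒∃HasRRedex-∈T r
  ... | t , d , ρ = nf t d ρ
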